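{- Let $[7,01,10]$ be the two-vertex Boolean network $f_1=\neg x_2$, $f_2=\neg x_1$. Every MBN built on $[7,01,10]$ with delay vector $(\alpha,\beta)$ satisfying $\alpha=\beta$ admits a limit cycle. Every MBN built on it with $\alpha\ne\beta$ has as its only attractors the fixed points $(0,\beta)$ and $(\alpha,0)$.
   Context: The MBN built on a two-vertex Boolean network $(f_1,f_2)$ with delay vector $(\alpha,\beta)$ of positive integers has configurations $(\rho,\gamma)$ with $0\le\rho\le\alpha$, $0\le\gamma\le\beta$, underlying Boolean state $x=([\rho\ge1],[\gamma\ge1])$, and dynamics: the first coordinate becomes $\alpha$ if $f_1(x)=1$, else $\max(\rho-1,0)$; the second becomes $\beta$ if $f_2(x)=1$, else $\max(\gamma-1,0)$. Attractors are periodic orbits: fixed points (length 1) and limit cycles (length $\ge2$). -}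

module Defs where

open import Data.Bool using (Bool; true; false; not)
open import Data.Nat using (ℕ; zero; suc; _≤_; _<_; _≥_; pred)
open import Data.Product using (_×_; _,_; proj₁; proj₂; ∃)
open import Relation.Binary.PropositionalEquality using (_≡_)
open import Relation.Nullary using (¬_)

record BN2 : Set where
  field
    f₁ : Bool → Bool → Bool
    f₂ : Bool → Bool → Bool

net7-01-10 : BN2
net7-01-10 = record { f₁ = λ x₁ x₂ → not x₂ ; f₂ = λ x₁ x₂ → not x₁ }

Config : Set
Config = ℕ × ℕ

Valid : ℕ → ℕ → Config → Set
Valid α β (ρ , γ) = ρ ≤ α × γ ≤ β

pos : ℕ → Bool
pos zero    = false
pos (suc _) = true

state : Config → Bool × Bool
state (ρ , γ) = pos ρ , pos γ

-- Update of one coordinate: becomes d if f = 1, else max(r-1,0) = pred r.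
upd : Bool → ℕ → ℕ → ℕ
upd true  d r = d
upd false d r = pred r

step : BN2 → ℕ → ℕ → Config → Config
step N α β (ρ , γ) =
  upd (BN2.f₁ N (pos ρ) (pos γ)) α ρ , upd (BN2.f₂ N (pos ρ) (pos γ)) β γ

iter : ℕ → (Config → Config) → Config → Config
iter zero    F c = c
iter (suc n) F c = F (iter n F c)

HasPeriod : BN2 → ℕ → ℕ → Config → ℕ → Set
HasPeriod N α β c p = 1 ≤ p × iter p (step N α β) c ≡ c

-- c lies on a periodic orbit (an attractor) of the MBN.
Periodic : BN2 → ℕ → ℕ → Config → Set
Periodic N α β c = Valid α β c × ∃ λ p → HasPeriod N α β c p

FixedPoint : BN2 → ℕ → ℕ → Config → Set
FixedPoint N α β c = Valid α β c × step N α β c ≡ c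

-- c lies on a limit cycle: a periodic orbit whose (minimal) length is ≥ 2,
-- i.e. c is periodic and returns to itself at no time p with 1 ≤ p < 2.
OnLimitCycle : BN2 → ℕ → ℕ → Config → Set
OnLimitCycle N α β c =
  Periodic N α β c × (∀ p → p < 2 → ¬ HasPeriod N α β c p)

{-# OPTIONS --safe #-}
module Submission where

-- While both counters are positive the MBN on [7,01,10] decrements them
-- together; as soon as exactly one is zero, the positive one is reset and the
-- other stays at zero, which is one of the fixed points (0 , β) and (α , 0);
-- and (0 , 0) jumps to (α , β). For α = β the diagonal descent from (α , α)
-- returns to (0 , 0), a cycle of length α + 1. For α ≠ β the descent keeps the
-- two counters distinct, so every configuration eventually reaches a fixed
-- point, and a periodic configuration that reaches a fixed point is that point.

open import Defs
open import Data.Nat using (ℕ; zero; suc; _+_; _*_; _∸_; _≤_; _<_; z≤n; s≤s)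
open import Data.Nat.Properties using (≤-refl; m≤m*n; m∸n+n≡m)
open import Data.Product using (_×_; _,_; ∃)
open import Data.Sum using (_⊎_; inj₁; inj₂)
open import Data.Empty using (⊥-elim)
open import Relation.Binary.PropositionalEquality
  using (_≡_; refl; sym; trans; cong; subst; module ≡-Reasoning)
open import Relation.Nullary using (¬_)

iter-+ : ∀ (G : Config → Config) m n c → iter (m + n) G c ≡ iter m G (iter n G c)
iter-+ G zero    n c = refl
iter-+ G (suc m) n c = cong G (iter-+ G m n c)

iter-suc-inside : ∀ (G : Config → Config) n c → iter (suc n) G c ≡ iter n G (G c)
iter-suc-inside G zero    c = refl
iter-suc-inside G (suc n) c = cong G (iter-suc-inside G n c)

iter-fixed : ∀ (G : Config → Config) m d → G d ≡ d → iter m G d ≡ d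
iter-fixed G zero    d fix = refl
iter-fixed G (suc m) d fix = trans (cong G (iter-fixed G m d fix)) fix

iter-*-period : ∀ (G : Config → Config) k p c → iter p G c ≡ c → iter (k * p) G c ≡ c
iter-*-period G zero    p c per = refl
iter-*-period G (suc k) p c per = begin
  iter (p + k * p) G c       ≡⟨ iter-+ G p (k * p) c ⟩
  iter p G (iter (k * p) G c) ≡⟨ cong (iter p G) (iter-*-period G k p c per) ⟩
  iter p G c                 ≡⟨ per ⟩
  c                          ∎
  where open ≡-Reasoning

iter-stable : ∀ (G : Config → Config) {n m} c d → n ≤ m → G d ≡ d →
              iter n G c ≡ d → iter m G c ≡ d
iter-stable G {n} {m} c d n≤m fix reach = begin
  iter m G c                    ≡⟨ cong (λ k → iter k G c) (sym (m∸n+n≡m n≤m)) ⟩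
  iter (m ∸ n + n) G c          ≡⟨ iter-+ G (m ∸ n) n c ⟩
  iter (m ∸ n) G (iter n G c)   ≡⟨ cong (iter (m ∸ n) G) reach ⟩
  iter (m ∸ n) G d              ≡⟨ iter-fixed G (m ∸ n) d fix ⟩
  d                             ∎
  where open ≡-Reasoning

Eventually : (Config → Config) → (Config → Set) → Config → Set
Eventually G P c = ∃ λ n → P (iter n G c)

eventually-pred : ∀ G P c → Eventually G P (G c) → Eventually G P c
eventually-pred G P c (n , Pn) = suc n , subst P (sym (iter-suc-inside G n c)) Pn

-- A periodic point returns to itself at multiples n * p of its period, which
-- are beyond the time n at which it has entered a set of fixed points.
periodic-eventually-fixed : ∀ G P c → (∀ d → P d → G d ≡ d) → Eventually G P c →
                            ∀ p → 1 ≤ p → iter p G c ≡ c → P c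
periodic-eventually-fixed G P c fixes (n , Pn) (suc p) _ per =
  subst P returns Pn
  where
  returns : iter n G c ≡ c
  returns = trans (sym (iter-stable G c _ (m≤m*n n (suc p)) (fixes _ Pn) refl))
                  (iter-*-period G n (suc p) c per)

mbn : ℕ → ℕ → Config → Config
mbn = step net7-01-10

top-fixed : ∀ α b → FixedPoint net7-01-10 α (suc b) (0 , suc b)
top-fixed α b = (z≤n , ≤-refl) , refl

right-fixed : ∀ a β → FixedPoint net7-01-10 (suc a) β (suc a , 0)
right-fixed a β = (≤-refl , z≤n) , refl

iter-diagonal-descent : ∀ α β k → iter k (mbn α β) (k , k) ≡ (0 , 0)
iter-diagonal-descent α β zero    = refl
iter-diagonal-descent α β (suc k) =
  trans (iter-suc-inside (mbn α β) k (suc k , suc k)) (iter-diagonal-descent α β k)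

origin-on-limit-cycle : ∀ a → OnLimitCycle net7-01-10 (suc a) (suc a) (0 , 0)
origin-on-limit-cycle a = ((z≤n , z≤n) , suc (suc a) , s≤s z≤n , returns) , not-fixed
  where
  returns : iter (suc (suc a)) (mbn (suc a) (suc a)) (0 , 0) ≡ (0 , 0)
  returns = trans (iter-suc-inside (mbn (suc a) (suc a)) (suc a) (0 , 0))
                  (iter-diagonal-descent (suc a) (suc a) (suc a))
  not-fixed : ∀ p → p < 2 → ¬ HasPeriod net7-01-10 (suc a) (suc a) (0 , 0) p
  not-fixed zero          _                 (() , _)
  not-fixed (suc zero)    _                 (_ , ())
  not-fixed (suc (suc p)) (s≤s (s≤s ())) _

module Unequal-delays (a b : ℕ) (a≢b : ¬ (suc a ≡ suc b)) where

  G : Config → Config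
  G = mbn (suc a) (suc b)

  IsFixedCorner : Config → Set
  IsFixedCorner c = c ≡ (0 , suc b) ⊎ c ≡ (suc a , 0)

  corner-fixed : ∀ c → IsFixedCorner c → G c ≡ c
  corner-fixed _ (inj₁ refl) = refl
  corner-fixed _ (inj₂ refl) = refl

  via-step : ∀ c → Eventually G IsFixedCorner (G c) → Eventually G IsFixedCorner c
  via-step = eventually-pred G IsFixedCorner

  off-diagonal-reaches-corner : ∀ r g → ¬ (r ≡ g) → Eventually G IsFixedCorner (r , g)
  off-diagonal-reaches-corner zero    zero    r≢g = ⊥-elim (r≢g refl)
  off-diagonal-reaches-corner zero    (suc g) _   = via-step _ (0 , inj₁ refl)
  off-diagonal-reaches-corner (suc r) zero    _   = via-step _ (0 , inj₂ refl)
  off-diagonal-reaches-corner (suc r) (suc g) r≢g =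
    via-step _ (off-diagonal-reaches-corner r g (λ r≡g → r≢g (cong suc r≡g)))

  reaches-corner : ∀ r g → Eventually G IsFixedCorner (r , g)
  reaches-corner zero    zero    =
    via-step _ (off-diagonal-reaches-corner (suc a) (suc b) a≢b)
  reaches-corner zero    (suc g) = via-step _ (0 , inj₁ refl)
  reaches-corner (suc r) zero    = via-step _ (0 , inj₂ refl)
  reaches-corner (suc r) (suc g) = via-step _ (reaches-corner r g)

  periodic-is-corner : ∀ c → Periodic net7-01-10 (suc a) (suc b) c → IsFixedCorner c
  periodic-is-corner (r , g) (_ , p , 1≤p , per) =
    periodic-eventually-fixed G IsFixedCorner (r , g) corner-fixed
      (reaches-corner r g) p 1≤p per

proposition15 :
    (∀ (α β : ℕ) → 1 ≤ α → 1 ≤ β → α ≡ β →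
       ∃ λ c → OnLimitCycle net7-01-10 α β c)
    ×
    (∀ (α β : ℕ) → 1 ≤ α → 1 ≤ β → ¬ (α ≡ β) →
       FixedPoint net7-01-10 α β (0 , β)
       × FixedPoint net7-01-10 α β (α , 0)
       × (∀ c → Periodic net7-01-10 α β c → c ≡ (0 , β) ⊎ c ≡ (α , 0)))
proposition15 = equal-delays , unequal-delays
  where
  equal-delays : ∀ (α β : ℕ) → 1 ≤ α → 1 ≤ β → α ≡ β →
                 ∃ λ c → OnLimitCycle net7-01-10 α β c
  equal-delays (suc a) _ _ _ refl = (0 , 0) , origin-on-limit-cycle a

  unequal-delays : ∀ (α β : ℕ) → 1 ≤ α → 1 ≤ β → ¬ (α ≡ β) →
                   FixedPoint net7-01-10 α β (0 , β)
                   × FixedPoint net7-01-10 α β (α , 0)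
                   × (∀ c → Periodic net7-01-10 α β c → c ≡ (0 , β) ⊎ c ≡ (α , 0))
  unequal-delays (suc a) (suc b) _ _ α≢β =
    top-fixed (suc a) b , right-fixed a (suc b) , Unequal-delays.periodic-is-corner a b α≢β
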